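{- Let $(P,\leq_p)$ be a countable poset. The following are equivalent: (1) for all $p\in P$, the set $\{p'\in P\mid p'\leq_p p\}$ is finite; (2) there is an injective order-preserving map from $(P,\leq_p)$ into $(\mathcal{P}_{<\omega}(\omega),\subseteq)$; (3) there is no injective order-preserving map from $\omega^\top$ into $P$, none from $\omega^*$ into $P$, and none from $\mathbb{N}^\top$ into $P$.
   Context: $\mathcal{P}_{<\omega}(\omega)$ is the set of finite subsets of $\omega$. An order-preserving map (homomorphism) $\varphi:P\to Q$ satisfies $p\leq p'\Rightarrow\varphi(p)\leq\varphi(p')$. The posets: $\omega^\top$ is $\omega\cup\{\top\}$ with the usual order on $\omega$ and $n<\top$ for all $n$; $\omega^*$ is $\omega$ with the reversed order ($\cdots<2<1<0$); $\mathbb{N}^\top$ is $\omega\cup\{\top\}$ where distinct natural numbers are pairwise incomparable and $n<\top$ for all $n$. -}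

module Defs where

open import Level using (Level; _⊔_)
open import Data.Nat using (ℕ; _≤_)
open import Data.Fin using (Fin)
open import Data.Maybe using (Maybe; just; nothing)
open import Data.List using (List)
open import Data.List.Relation.Binary.Subset.Propositional using (_⊆_)
open import Data.Product using (Σ; Σ-syntax; _×_; proj₁)
open import Data.Empty using (⊥)
open import Data.Unit using (⊤)
open import Relation.Binary.PropositionalEquality using (_≡_)
open import Relation.Binary.Bundles using (Poset)

module _ {c ℓ₁ ℓ₂ : Level} (P : Poset c ℓ₁ ℓ₂) where
  open Poset P renaming (Carrier to |P|; _≤_ to _≤P_)

  Countable : Set (c ⊔ ℓ₁)
  Countable = Σ (|P| → ℕ) λ f → ∀ x y → f x ≡ f y → x ≈ y

  FiniteDownSet : |P| → Set (c ⊔ ℓ₁ ⊔ ℓ₂)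
  FiniteDownSet p =
    Σ[ n ∈ ℕ ] Σ[ f ∈ (Fin n → Σ[ q ∈ |P| ] q ≤P p) ]
      (∀ q → q ≤P p → Σ[ i ∈ Fin n ] proj₁ (f i) ≈ q)

  LocallyFiniteBelow : Set (c ⊔ ℓ₁ ⊔ ℓ₂)
  LocallyFiniteBelow = ∀ p → FiniteDownSet p

  -- Finite subsets of ω are represented by lists of naturals (as sets of
  -- their members), ordered by inclusion ⊆.
  -- Condition (2): injective order-preserving map into (P_<ω(ω), ⊆).
  EmbedsInFinSubsets : Set (c ⊔ ℓ₁ ⊔ ℓ₂)
  EmbedsInFinSubsets =
    Σ[ φ ∈ (|P| → List ℕ) ]
      ((∀ p q → p ≤P q → φ p ⊆ φ q) ×
       (∀ p q → φ p ⊆ φ q → φ q ⊆ φ p → p ≈ q))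

  InjHomInto : {a r : Level} (A : Set a) (R : A → A → Set r) → Set (a ⊔ r ⊔ c ⊔ ℓ₁ ⊔ ℓ₂)
  InjHomInto A R =
    Σ[ f ∈ (A → |P|) ]
      ((∀ x y → R x y → f x ≤P f y) × (∀ x y → f x ≈ f y → x ≡ y))

_≤ω⊤_ : Maybe ℕ → Maybe ℕ → Set
just m  ≤ω⊤ just n  = m ≤ n
just _  ≤ω⊤ nothing = ⊤
nothing ≤ω⊤ just _  = ⊥
nothing ≤ω⊤ nothing = ⊤

_≤ω*_ : ℕ → ℕ → Set
m ≤ω* n = n ≤ m

_≤ℕ⊤_ : Maybe ℕ → Maybe ℕ → Set
just m  ≤ℕ⊤ just n  = m ≡ n
just _  ≤ℕ⊤ nothing = ⊤
nothing ≤ℕ⊤ just _  = ⊥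
nothing ≤ℕ⊤ nothing = ⊤

module _ {c ℓ₁ ℓ₂ : Level} (P : Poset c ℓ₁ ℓ₂) where
  NoBadSubposets : Set (c ⊔ ℓ₁ ⊔ ℓ₂)
  NoBadSubposets =
    (InjHomInto P (Maybe ℕ) _≤ω⊤_ → ⊥) ×
    (InjHomInto P ℕ _≤ω*_ → ⊥) ×
    (InjHomInto P (Maybe ℕ) _≤ℕ⊤_ → ⊥)

-- A finite subset of ω has only finitely many subsets, so an embedding into
-- (P_<ω(ω), ⊆) leaves no room for infinitely many distinct elements below a
-- single one, as the tops of ω^⊤ and ℕ^⊤ and the 0 of ω^* would be. Conversely, if some
-- down-set were infinite, excluded middle lets us pick distinct elements strictly
-- below p one after another, giving a copy of ℕ^⊤ with top p. Finally, sending p to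
-- the codes of its (finite) down-set is an embedding, once every ≈-class is coded
-- by the least code of its members.
module Submission where

open import Defs
open import Level using (Level; _⊔_)
open import Function using (_∘_)
open import Data.Product using (_×_; Σ; Σ-syntax; _,_; proj₁; proj₂)
open import Data.Sum using (inj₁; inj₂)
open import Data.Empty using (⊥; ⊥-elim)
open import Data.Unit using (tt)
open import Data.Nat using (ℕ; zero; suc; _+_; _<_; _≤_; z≤n; s≤s⁻¹)
open import Data.Nat.Properties
  using (_≟_; +-suc; +-identityʳ; m≤n⇒m<n∨m≡n; <-cmp; <-irrefl; ≮⇒≥; ≤-antisym; n<1+n)
open import Data.Fin using (Fin; toℕ)
open import Data.Fin.Properties using (pigeonhole)
open import Data.Maybe using (Maybe; just; nothing)
open import Data.Maybe.Properties using (just-injective)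
open import Data.List using (List; []; _∷_; _++_; map; filter; length; lookup; tabulate)
open import Data.List.Relation.Unary.Any as Any using (Any; here; there)
open import Data.List.Relation.Unary.Any.Properties using (lookup-index; map⁺)
open import Data.List.Membership.Propositional using (_∈_)
open import Data.List.Membership.Propositional.Properties
  using (∈-++⁺ˡ; ∈-++⁺ʳ; ∈-map⁺; ∈-filter⁺; ∈-filter⁻; ∈-tabulate⁺; ∈-tabulate⁻)
open import Data.List.Membership.DecPropositional _≟_ using (_∈?_)
open import Data.List.Relation.Binary.Subset.Propositional using (_⊆_)
open import Data.Bool using (true; false)
open import Relation.Nullary using (yes; no; ¬_; does)
open import Relation.Unary using (Decidable)
open import Relation.Binary.Bundles using (Setoid; Poset)
open import Relation.Binary.Definitions using (tri<; tri≈; tri>)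
open import Relation.Binary.PropositionalEquality as ≡ using (_≡_; refl)
open import Axiom.ExcludedMiddle using (ExcludedMiddle)
open import Axiom.DoubleNegationElimination using (DoubleNegationElimination; em⇒dne)

module _ {q} {Q : ℕ → Set q} where

  IsLeast : ℕ → Set q
  IsLeast n = Q n × (∀ m → m < n → ¬ Q m)

  least-≤ : ∀ {m n} → IsLeast n → Q m → n ≤ m
  least-≤ (_ , below) qm = ≮⇒≥ (λ m<n → below _ m<n qm)

  least : Decidable Q → ∀ {k} → Q k → Σ ℕ IsLeast
  least Q? {k} qk = search k 0 (λ _ ()) (≡.subst Q (≡.sym (+-identityʳ k)) qk)
    where
    search : ∀ d i → (∀ m → m < i → ¬ Q m) → Q (d + i) → Σ ℕ IsLeast
    search zero    i none qi = i , qi , none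
    search (suc d) i none q with Q? i
    ... | yes qi = i , qi , none
    ... | no ¬qi = search d (suc i) none′ (≡.subst Q (≡.sym (+-suc d i)) q)
      where
      none′ : ∀ m → m < suc i → ¬ Q m
      none′ m m<1+i with m≤n⇒m<n∨m≡n (s≤s⁻¹ m<1+i)
      ... | inj₁ m<i = none m m<i
      ... | inj₂ refl = ¬qi

∈-sequence-repeats : ∀ {a} {A : Set a} (xs : List A) (f : ℕ → A) → (∀ n → f n ∈ xs) →
                     Σ[ i ∈ ℕ ] Σ[ j ∈ ℕ ] (i < j × f i ≡ f j)
∈-sequence-repeats xs f f∈xs with pigeonhole (n<1+n (length xs)) (Any.index ∘ f∈xs ∘ toℕ)
... | i , j , i<j , same-index = toℕ i , toℕ j , i<j ,
  ≡.trans (lookup-index (f∈xs (toℕ i)))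
    (≡.trans (≡.cong (lookup xs) same-index) (≡.sym (lookup-index (f∈xs (toℕ j)))))

sublists : List ℕ → List (List ℕ)
sublists []       = [] ∷ []
sublists (x ∷ xs) = map (x ∷_) (sublists xs) ++ sublists xs

filter∈sublists : ∀ {p} {Q : ℕ → Set p} (Q? : Decidable Q) xs → filter Q? xs ∈ sublists xs
filter∈sublists Q? []       = here refl
filter∈sublists Q? (x ∷ xs) with does (Q? x)
... | true  = ∈-++⁺ˡ (∈-map⁺ (x ∷_) (filter∈sublists Q? xs))
... | false = ∈-++⁺ʳ (map (x ∷_) (sublists xs)) (filter∈sublists Q? xs)

restrict : List ℕ → List ℕ → List ℕ
restrict L S = filter (_∈? S) L

restrict-injective-⊆ : ∀ {L S T} → S ⊆ L → restrict L S ≡ restrict L T → S ⊆ T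
restrict-injective-⊆ {L} {S} {T} S⊆L same x∈S =
  proj₂ (∈-filter⁻ (_∈? T) {xs = L} (≡.subst (_ ∈_) same (∈-filter⁺ (_∈? S) (S⊆L x∈S) x∈S)))

subset-sequence-repeats : (L : List ℕ) (S : ℕ → List ℕ) → (∀ n → S n ⊆ L) →
                          Σ[ i ∈ ℕ ] Σ[ j ∈ ℕ ] (i < j × S i ⊆ S j × S j ⊆ S i)
subset-sequence-repeats L S S⊆L
  with ∈-sequence-repeats (sublists L) (restrict L ∘ S) (λ n → filter∈sublists (_∈? S n) L)
... | i , j , i<j , same =
  i , j , i<j , restrict-injective-⊆ (S⊆L i) same , restrict-injective-⊆ (S⊆L j) (≡.sym same)

module _ {a ℓ} (S : Setoid a ℓ) where
  open Setoid S renaming (Carrier to A; refl to ≈-refl; sym to ≈-sym; trans to ≈-trans)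

  canonical-code : ExcludedMiddle (a ⊔ ℓ) →
                   (code : A → ℕ) → (∀ x y → code x ≡ code y → x ≈ y) →
                   Σ[ κ ∈ (A → ℕ) ] ((∀ {x y} → x ≈ y → κ x ≡ κ y) × (∀ {x y} → κ x ≡ κ y → x ≈ y))
  canonical-code em code code-injective = κ , κ-resp , κ-injective
    where
    CodeOfClass : A → ℕ → Set (a ⊔ ℓ)
    CodeOfClass x n = Σ[ y ∈ A ] (y ≈ x × code y ≡ n)

    class-resp : ∀ {x x′ n} → x ≈ x′ → CodeOfClass x n → CodeOfClass x′ n
    class-resp x≈x′ (y , y≈x , e) = y , ≈-trans y≈x x≈x′ , e

    least-code : ∀ x → Σ ℕ (IsLeast {Q = CodeOfClass x})
    least-code x = least (λ _ → em) (x , ≈-refl , refl)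

    κ : A → ℕ
    κ = proj₁ ∘ least-code

    κ-is-code : ∀ x → CodeOfClass x (κ x)
    κ-is-code x = proj₁ (proj₂ (least-code x))

    κ-resp : ∀ {x y} → x ≈ y → κ x ≡ κ y
    κ-resp {x} {y} x≈y = ≤-antisym
      (least-≤ (proj₂ (least-code x)) (class-resp (≈-sym x≈y) (κ-is-code y)))
      (least-≤ (proj₂ (least-code y)) (class-resp x≈y (κ-is-code x)))

    κ-injective : ∀ {x y} → κ x ≡ κ y → x ≈ y
    κ-injective {x} {y} e with κ-is-code x | κ-is-code y
    ... | z , z≈x , ez | w , w≈y , ew =
      ≈-trans (≈-sym z≈x) (≈-trans (code-injective z w (≡.trans ez (≡.trans e (≡.sym ew)))) w≈y)

  module _ {u} (U : A → Set u) where

    _∈≈_ : A → List (Σ A U) → Set (a ⊔ ℓ ⊔ u)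
    x ∈≈ xs = Any (λ e → proj₁ e ≈ x) xs

    Listable : Set (a ⊔ ℓ ⊔ u)
    Listable = Σ[ xs ∈ List (Σ A U) ] (∀ x → U x → x ∈≈ xs)

    unlistable⇒injective-sequence :
      ExcludedMiddle (a ⊔ ℓ ⊔ u) → ¬ Listable →
      Σ[ s ∈ (ℕ → Σ A U) ] (∀ i j → proj₁ (s i) ≈ proj₁ (s j) → i ≡ j)
    unlistable⇒injective-sequence em unlistable = s , s-injective
      where
      dne : DoubleNegationElimination (a ⊔ ℓ ⊔ u)
      dne = em⇒dne em

      fresh : ∀ xs → Σ[ e ∈ Σ A U ] ¬ (proj₁ e ∈≈ xs)
      fresh xs = dne λ ¬fresh → unlistable (xs , λ x u → dne λ x∉ → ¬fresh ((x , u) , x∉))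

      prefix : ℕ → List (Σ A U)
      prefix zero    = []
      prefix (suc n) = proj₁ (fresh (prefix n)) ∷ prefix n

      s : ℕ → Σ A U
      s n = proj₁ (fresh (prefix n))

      earlier-in-prefix : ∀ {i j} → i < j → proj₁ (s i) ∈≈ prefix j
      earlier-in-prefix {i} {suc j} i<1+j with m≤n⇒m<n∨m≡n (s≤s⁻¹ i<1+j)
      ... | inj₁ i<j  = there (earlier-in-prefix i<j)
      ... | inj₂ refl = here ≈-refl

      apart : ∀ {i j} → i < j → ¬ proj₁ (s i) ≈ proj₁ (s j)
      apart {j = j} i<j e = proj₂ (fresh (prefix j)) (Any.map (λ d → ≈-trans d e) (earlier-in-prefix i<j))

      s-injective : ∀ i j → proj₁ (s i) ≈ proj₁ (s j) → i ≡ j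
      s-injective i j e with <-cmp i j
      ... | tri< i<j _ _ = ⊥-elim (apart i<j e)
      ... | tri≈ _ i≡j _ = i≡j
      ... | tri> _ _ j<i = ⊥-elim (apart j<i (≈-sym e))

module _ {c ℓ₁ ℓ₂ : Level} (P : Poset c ℓ₁ ℓ₂) where
  open Poset P renaming (Carrier to |P|; _≤_ to _≤P_; refl to ≤-refl; trans to ≤-trans)
  open import Relation.Binary.Construct.NonStrictToStrict _≈_ _≤P_ using () renaming (_<_ to _<P_)

  embedding⇒no-injective-sequence-below :
    EmbedsInFinSubsets P → (t : |P|) (h : ℕ → |P|) → (∀ n → h n ≤P t) →
    ¬ (∀ i j → h i ≈ h j → i ≡ j)
  embedding⇒no-injective-sequence-below (φ , mono , reflect) t h h≤t h-injective
    with subset-sequence-repeats (φ t) (φ ∘ h) (λ n → mono _ _ (h≤t n))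
  ... | i , j , i<j , ⊆₁ , ⊆₂ = <-irrefl (h-injective i j (reflect _ _ ⊆₁ ⊆₂)) i<j

  embedding⇒no-bad-subposets : EmbedsInFinSubsets P → NoBadSubposets P
  embedding⇒no-bad-subposets E =
      (λ (f , hom , inj) → topped f (λ n → hom (just n) nothing tt) inj)
    , (λ (f , hom , inj) → no-sequence (f 0) f (λ n → hom n 0 z≤n) inj)
    , (λ (f , hom , inj) → topped f (λ n → hom (just n) nothing tt) inj)
    where
    no-sequence : (t : |P|) (h : ℕ → |P|) → (∀ n → h n ≤P t) → ¬ (∀ i j → h i ≈ h j → i ≡ j)
    no-sequence = embedding⇒no-injective-sequence-below E

    topped : (f : Maybe ℕ → |P|) → (∀ n → f (just n) ≤P f nothing) →
             (∀ x y → f x ≈ f y → x ≡ y) → ⊥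
    topped f below f-injective =
      no-sequence (f nothing) (f ∘ just) below (λ i j e → just-injective (f-injective _ _ e))

  listable⇒finite-down-set : ∀ {p} → Listable Eq.setoid (_≤P p) → FiniteDownSet P p
  listable⇒finite-down-set (xs , covers) =
    length xs , lookup xs , λ q q≤p → Any.index (covers q q≤p) , lookup-index (covers q q≤p)

  strictly-below-listable⇒down-set-listable :
    ExcludedMiddle ℓ₁ → ∀ {p} → Listable Eq.setoid (_<P p) → Listable Eq.setoid (_≤P p)
  strictly-below-listable⇒down-set-listable em {p} (xs , covers) =
    (p , ≤-refl) ∷ map weaken xs , covers′
    where
    weaken : Σ |P| (_<P p) → Σ |P| (_≤P p)
    weaken (q , q≤p , _) = q , q≤p

    covers′ : ∀ q → q ≤P p → _∈≈_ Eq.setoid (_≤P p) q ((p , ≤-refl) ∷ map weaken xs)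
    covers′ q q≤p with em {q ≈ p}
    ... | yes q≈p = here (Eq.sym q≈p)
    ... | no  q≉p = there (map⁺ (covers q (q≤p , q≉p)))

  no-ℕ⊤⇒strictly-below-listable :
    ExcludedMiddle (c ⊔ ℓ₁ ⊔ ℓ₂) → ¬ InjHomInto P (Maybe ℕ) _≤ℕ⊤_ →
    ∀ p → Listable Eq.setoid (_<P p)
  no-ℕ⊤⇒strictly-below-listable em no-ℕ⊤ p with em {Listable Eq.setoid (_<P p)}
  ... | yes listable = listable
  ... | no unlistable with unlistable⇒injective-sequence Eq.setoid (_<P p) em unlistable
  ... | s , s-injective = ⊥-elim (no-ℕ⊤ (f , f-mono , f-injective))
    where
    f : Maybe ℕ → |P|
    f (just n) = proj₁ (s n)
    f nothing  = p

    f-mono : ∀ x y → x ≤ℕ⊤ y → f x ≤P f y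
    f-mono (just m) (just n) refl = ≤-refl
    f-mono (just m) nothing  _    = proj₁ (proj₂ (s m))
    f-mono nothing  nothing  _    = ≤-refl

    f-injective : ∀ x y → f x ≈ f y → x ≡ y
    f-injective (just m) (just n) e = ≡.cong just (s-injective m n e)
    f-injective (just m) nothing  e = ⊥-elim (proj₂ (proj₂ (s m)) e)
    f-injective nothing  (just n) e = ⊥-elim (proj₂ (proj₂ (s n)) (Eq.sym e))
    f-injective nothing  nothing  _ = refl

  finite-down-sets⇒embedding :
    ExcludedMiddle (c ⊔ ℓ₁) → Countable P → LocallyFiniteBelow P → EmbedsInFinSubsets P
  finite-down-sets⇒embedding em (code , code-injective) finite = φ , φ-mono , φ-reflects-≈
    where
    canonical : Σ[ κ ∈ (|P| → ℕ) ] ((∀ {x y} → x ≈ y → κ x ≡ κ y) × (∀ {x y} → κ x ≡ κ y → x ≈ y))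
    canonical = canonical-code Eq.setoid em code code-injective

    κ : |P| → ℕ
    κ = proj₁ canonical

    κ-resp : ∀ {x y} → x ≈ y → κ x ≡ κ y
    κ-resp = proj₁ (proj₂ canonical)

    κ-injective : ∀ {x y} → κ x ≡ κ y → x ≈ y
    κ-injective = proj₂ (proj₂ canonical)

    enum : ∀ p → Fin (proj₁ (finite p)) → Σ |P| (_≤P p)
    enum p = proj₁ (proj₂ (finite p))

    enum-covers : ∀ p q → q ≤P p → Σ[ i ∈ Fin (proj₁ (finite p)) ] proj₁ (enum p i) ≈ q
    enum-covers p = proj₂ (proj₂ (finite p))

    φ : |P| → List ℕ
    φ p = tabulate (κ ∘ proj₁ ∘ enum p)

    φ-mono : ∀ p q → p ≤P q → φ p ⊆ φ q
    φ-mono p q p≤q n∈φp with ∈-tabulate⁻ n∈φp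
    ... | i , refl with enum-covers q (proj₁ (enum p i)) (≤-trans (proj₂ (enum p i)) p≤q)
    ... | j , e = ≡.subst (_∈ φ q) (κ-resp e) (∈-tabulate⁺ j)

    φ-reflects-≤ : ∀ p q → φ p ⊆ φ q → p ≤P q
    φ-reflects-≤ p q φp⊆φq with enum-covers p p ≤-refl
    ... | i , e with ∈-tabulate⁻ (φp⊆φq (∈-tabulate⁺ {f = κ ∘ proj₁ ∘ enum p} i))
    ... | j , same = ≤-trans (reflexive (Eq.trans (Eq.sym e) (κ-injective same))) (proj₂ (enum q j))

    φ-reflects-≈ : ∀ p q → φ p ⊆ φ q → φ q ⊆ φ p → p ≈ q
    φ-reflects-≈ p q ⊆₁ ⊆₂ = antisym (φ-reflects-≤ p q ⊆₁) (φ-reflects-≤ q p ⊆₂)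

proposition15 : {c ℓ₁ ℓ₂ : Level} → ((a : Level) → ExcludedMiddle a) →
    (P : Poset c ℓ₁ ℓ₂) → Countable P →
    ((LocallyFiniteBelow P → EmbedsInFinSubsets P) ×
     (EmbedsInFinSubsets P → NoBadSubposets P) ×
     (NoBadSubposets P → LocallyFiniteBelow P))
proposition15 em P countable =
    finite-down-sets⇒embedding P (em _) countable
  , embedding⇒no-bad-subposets P
  , λ (_ , _ , no-ℕ⊤) p →
      listable⇒finite-down-set P
        (strictly-below-listable⇒down-set-listable P (em _)
          (no-ℕ⊤⇒strictly-below-listable P (em _) no-ℕ⊤ p))
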